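{- Let $G$ be a finite simple graph on at least two vertices with maximum degree $\Delta(G)$, let $k$ be a positive integer, and let $\Theta$ be a $k$-coalition partition of $G$ of maximum cardinality (i.e. $|\Theta|=C_k(G)$). Then every $A\in\Theta$ forms a $k$-coalition with at most $\max\{1,\Delta(G)-k+2\}$ sets in $\Theta$.
   Context: For a positive integer $k$, a set $S\subseteq V(G)$ is a $k$-dominating set of $G$ if every vertex $v\in V(G)\setminus S$ has at least $k$ neighbors in $S$. Two disjoint sets $A,B\subseteq V(G)$ form a $k$-coalition if neither $A$ nor $B$ is a $k$-dominating set of $G$ but $A\cup B$ is a $k$-dominating set of $G$. A $k$-coalition partition of $G$ is a partition $\Theta$ of $V(G)$ such that every set in $\Theta$ is either a $k$-dominating set of cardinality $k$ or forms a $k$-coalition with another set of $\Theta$. The $k$-coalition number $C_k(G)$ is the maximum cardinality of a $k$-coalition partition of $G$. -}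

module Defs where

open import Data.Nat using (ℕ; zero; suc; _+_; _∸_; _≤_; _⊔_)
open import Data.Fin using (Fin; zero; suc)
open import Data.Fin.Subset using (Subset; _∈_; _∉_; _∩_; _∪_; ∣_∣; Nonempty)
open import Data.Bool using (Bool; true; false)
open import Data.Vec using (tabulate)
open import Data.Product using (Σ; ∃; _×_)
open import Data.Sum using (_⊎_)
open import Relation.Nullary using (¬_)
open import Relation.Binary.PropositionalEquality using (_≡_)

record Graph (n : ℕ) : Set where
  field
    adj    : Fin n → Fin n → Bool
    sym    : ∀ u v → adj u v ≡ adj v u
    irrefl : ∀ v → adj v v ≡ false
open Graph public

N : ∀ {n} → Graph n → Fin n → Subset n
N G v = tabulate (adj G v)

degree : ∀ {n} → Graph n → Fin n → ℕ
degree G v = ∣ N G v ∣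

maxFin : ∀ {n} → (Fin n → ℕ) → ℕ
maxFin {zero}  f = 0
maxFin {suc n} f = f zero ⊔ maxFin {n} (λ i → f (suc i))

Δ : ∀ {n} → Graph n → ℕ
Δ G = maxFin (degree G)

KDominating : ∀ {n} → ℕ → Graph n → Subset n → Set
KDominating k G S = ∀ v → v ∉ S → k ≤ ∣ S ∩ N G v ∣

Disjoint : ∀ {n} → Subset n → Subset n → Set
Disjoint A B = ∀ v → v ∈ A → v ∉ B

KCoalition : ∀ {n} → ℕ → Graph n → Subset n → Subset n → Set
KCoalition k G A B =
  Disjoint A B × ¬ KDominating k G A × ¬ KDominating k G B × KDominating k G (A ∪ B)

IsPartition : ∀ {n m} → (Fin m → Subset n) → Set
IsPartition {n} {m} Θ =
  (∀ i → Nonempty (Θ i)) ×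
  (∀ (v : Fin n) → ∃ λ i → v ∈ Θ i) ×
  (∀ i j (v : Fin n) → v ∈ Θ i → v ∈ Θ j → i ≡ j)

IsKCoalitionPartition : ∀ {n m} → ℕ → Graph n → (Fin m → Subset n) → Set
IsKCoalitionPartition {n} {m} k G Θ =
  IsPartition Θ ×
  (∀ i → (KDominating k G (Θ i) × ∣ Θ i ∣ ≡ k)
         ⊎ (∃ λ j → KCoalition k G (Θ i) (Θ j)))

IsMaxKCoalitionPartition : ∀ {n m} → ℕ → Graph n → (Fin m → Subset n) → Set
IsMaxKCoalitionPartition {n} {m} k G Θ =
  IsKCoalitionPartition k G Θ ×
  (∀ m′ (Θ′ : Fin m′ → Subset n) → IsKCoalitionPartition k G Θ′ → m′ ≤ m)

{-# OPTIONS --safe #-}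
module Submission where

-- Since Θ(i) is not k-dominating, some x ∉ Θ(i) has a < k neighbours in Θ(i).  Every
-- coalition partner Θ(j) of Θ(i) not containing x must supply the missing k − a
-- neighbours of x, and these neighbour sets are pairwise disjoint and disjoint from
-- Θ(i).  Hence, if c partners avoid x, then c(k − a) + a ≤ deg x ≤ Δ, which for c ≥ 1
-- gives c ≤ Δ − k + 1.  At most one further partner, the block containing x, exists.

open import Defs hiding (sym)
open import Data.Nat using (ℕ; zero; suc; _+_; _*_; _∸_; _≤_; _<_; _⊔_; z≤n; s≤s)
open import Data.Nat.Properties hiding (suc-injective; 0≢1+n)
open import Data.Fin using (Fin; zero; suc)
open import Data.Fin.Properties using (¬∀⟶∃¬; 0≢1+n; suc-injective)
open import Data.Fin.Subset using (Subset; _∈_; _∉_; _∩_; _∪_; ∁; ⁅_⁆; ∣_∣; _⊆_; inside; outside)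
open import Data.Fin.Subset.Properties
open import Data.Vec using ([]; _∷_; here; there)
open import Data.Product using (∃; _×_; _,_; proj₁; proj₂)
open import Data.Sum using ([_,_])
open import Data.Empty using (⊥-elim)
open import Relation.Nullary using (¬_; yes; no; ¬?)
open import Relation.Nullary.Decidable using (_→-dec_)
open import Relation.Binary.PropositionalEquality using (_≡_; refl; sym; trans; cong; subst; module ≡-Reasoning)

∣p∪q∣≤∣p∣+∣q∣ : ∀ {n} (p q : Subset n) → ∣ p ∪ q ∣ ≤ ∣ p ∣ + ∣ q ∣
∣p∪q∣≤∣p∣+∣q∣ []            []            = z≤n
∣p∪q∣≤∣p∣+∣q∣ (outside ∷ p) (outside ∷ q) = ∣p∪q∣≤∣p∣+∣q∣ p q
∣p∪q∣≤∣p∣+∣q∣ (inside  ∷ p) (outside ∷ q) = s≤s (∣p∪q∣≤∣p∣+∣q∣ p q)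
∣p∪q∣≤∣p∣+∣q∣ (outside ∷ p) (inside  ∷ q) =
  ≤-trans (s≤s (∣p∪q∣≤∣p∣+∣q∣ p q)) (≤-reflexive (sym (+-suc ∣ p ∣ ∣ q ∣)))
∣p∪q∣≤∣p∣+∣q∣ (inside  ∷ p) (inside  ∷ q) =
  s≤s (≤-trans (∣p∪q∣≤∣p∣+∣q∣ p q) (+-monoʳ-≤ ∣ p ∣ (n≤1+n ∣ q ∣)))

∣p∩q∣+∣p∩∁q∣≡∣p∣ : ∀ {n} (p q : Subset n) → ∣ p ∩ q ∣ + ∣ p ∩ ∁ q ∣ ≡ ∣ p ∣
∣p∩q∣+∣p∩∁q∣≡∣p∣ []            []            = refl
∣p∩q∣+∣p∩∁q∣≡∣p∣ (outside ∷ p) (_       ∷ q) = ∣p∩q∣+∣p∩∁q∣≡∣p∣ p q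
∣p∩q∣+∣p∩∁q∣≡∣p∣ (inside  ∷ p) (inside  ∷ q) = cong suc (∣p∩q∣+∣p∩∁q∣≡∣p∣ p q)
∣p∩q∣+∣p∩∁q∣≡∣p∣ (inside  ∷ p) (outside ∷ q) = begin
  ∣ p ∩ q ∣ + suc ∣ p ∩ ∁ q ∣  ≡⟨ +-suc ∣ p ∩ q ∣ ∣ p ∩ ∁ q ∣ ⟩
  suc (∣ p ∩ q ∣ + ∣ p ∩ ∁ q ∣) ≡⟨ cong suc (∣p∩q∣+∣p∩∁q∣≡∣p∣ p q) ⟩
  suc ∣ p ∣                     ∎
  where open ≡-Reasoning

∣p∣≤1+∣p∩∁⁅x⁆∣ : ∀ {n} (p : Subset n) x → ∣ p ∣ ≤ suc ∣ p ∩ ∁ ⁅ x ⁆ ∣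
∣p∣≤1+∣p∩∁⁅x⁆∣ p x = begin
  ∣ p ∣                                 ≡⟨ ∣p∩q∣+∣p∩∁q∣≡∣p∣ p ⁅ x ⁆ ⟨
  ∣ p ∩ ⁅ x ⁆ ∣ + ∣ p ∩ ∁ ⁅ x ⁆ ∣      ≤⟨ +-monoˡ-≤ _ (∣p∩q∣≤∣q∣ p ⁅ x ⁆) ⟩
  ∣ ⁅ x ⁆ ∣ + ∣ p ∩ ∁ ⁅ x ⁆ ∣          ≡⟨ cong (_+ ∣ p ∩ ∁ ⁅ x ⁆ ∣) (∣⁅x⁆∣≡1 x) ⟩
  suc ∣ p ∩ ∁ ⁅ x ⁆ ∣                   ∎
  where open ≤-Reasoning

PairwiseDisjoint : ∀ {n m} → (Fin m → Subset n) → Set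
PairwiseDisjoint F = ∀ i j v → v ∈ F i → v ∈ F j → i ≡ j

pairwiseDisjoint-tail : ∀ {n m} {F : Fin (suc m) → Subset n} →
  PairwiseDisjoint F → PairwiseDisjoint (λ j → F (suc j))
pairwiseDisjoint-tail disjoint i j v v∈Fi v∈Fj = suc-injective (disjoint (suc i) (suc j) v v∈Fi v∈Fj)

disjoint-family-card : ∀ {n m} (F : Fin m → Subset n) (P : Subset m) {S : Subset n} {t : ℕ} →
  PairwiseDisjoint F →
  (∀ j → j ∈ P → F j ⊆ S) →
  (∀ j → j ∈ P → t ≤ ∣ F j ∣) →
  ∣ P ∣ * t ≤ ∣ S ∣
disjoint-family-card F [] _ _ _ = z≤n
disjoint-family-card F (outside ∷ P) disjoint inside-S large =
  disjoint-family-card (λ j → F (suc j)) P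
    (pairwiseDisjoint-tail disjoint)
    (λ j j∈P → inside-S (suc j) (there j∈P))
    (λ j j∈P → large (suc j) (there j∈P))
disjoint-family-card F (inside ∷ P) {S} {t} disjoint inside-S large = begin
  t + ∣ P ∣ * t                        ≤⟨ +-mono-≤ (large zero here) rest ⟩
  ∣ F zero ∣ + ∣ S ∩ ∁ (F zero) ∣      ≤⟨ +-monoˡ-≤ _ (p⊆q⇒∣p∣≤∣q∣ F₀⊆S∩F₀) ⟩
  ∣ S ∩ F zero ∣ + ∣ S ∩ ∁ (F zero) ∣  ≡⟨ ∣p∩q∣+∣p∩∁q∣≡∣p∣ S (F zero) ⟩
  ∣ S ∣                                ∎
  where
  open ≤-Reasoning
  F₀⊆S∩F₀ : F zero ⊆ S ∩ F zero
  F₀⊆S∩F₀ v∈F₀ = x∈p∩q⁺ (inside-S zero here v∈F₀ , v∈F₀)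
  rest : ∣ P ∣ * t ≤ ∣ S ∩ ∁ (F zero) ∣
  rest = disjoint-family-card (λ j → F (suc j)) P
    (pairwiseDisjoint-tail disjoint)
    (λ j j∈P v∈Fj → x∈p∩q⁺ (inside-S (suc j) (there j∈P) v∈Fj ,
                            x∉p⇒x∈∁p (λ v∈F₀ → 0≢1+n (disjoint zero (suc j) _ v∈F₀ v∈Fj))))
    (λ j j∈P → large (suc j) (there j∈P))

≤maxFin : ∀ {n} (f : Fin n → ℕ) i → f i ≤ maxFin f
≤maxFin f zero    = m≤m⊔n _ _
≤maxFin f (suc i) = ≤-trans (≤maxFin (λ j → f (suc j)) i) (m≤n⊔m _ _)

degree≤Δ : ∀ {n} (G : Graph n) v → degree G v ≤ Δ G
degree≤Δ G = ≤maxFin (degree G)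

¬KDominating⇒∃undominated : ∀ {n k} {G : Graph n} {S : Subset n} →
  ¬ KDominating k G S → ∃ λ v → v ∉ S × ∣ S ∩ N G v ∣ < k
¬KDominating⇒∃undominated {n} {k} {G} {S} ¬dom
  with ¬∀⟶∃¬ n _ (λ v → ¬? (v ∈? S) →-dec (k ≤? ∣ S ∩ N G v ∣)) ¬dom
... | v , ¬dominated =
  v , (λ v∈S → ¬dominated (λ v∉S → ⊥-elim (v∉S v∈S))) , ≰⇒> (λ k≤ → ¬dominated (λ _ → k≤))

coalition-partner-supplies : ∀ {n k} {G : Graph n} {A B : Subset n} {x} →
  KCoalition k G A B → x ∉ A → x ∉ B → k ∸ ∣ A ∩ N G x ∣ ≤ ∣ B ∩ N G x ∣
coalition-partner-supplies {k = k} {G} {A} {B} {x} (_ , _ , _ , A∪B-dom) x∉A x∉B =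
  m≤n+o⇒m∸n≤o k _ (begin
    k                              ≤⟨ A∪B-dom x (λ x∈A∪B → [ x∉A , x∉B ] (x∈p∪q⁻ A B x∈A∪B)) ⟩
    ∣ (A ∪ B) ∩ N G x ∣            ≡⟨ cong ∣_∣ (∩-distribʳ-∪ (N G x) A B) ⟩
    ∣ A ∩ N G x ∪ B ∩ N G x ∣      ≤⟨ ∣p∪q∣≤∣p∣+∣q∣ (A ∩ N G x) (B ∩ N G x) ⟩
    ∣ A ∩ N G x ∣ + ∣ B ∩ N G x ∣  ∎)
  where open ≤-Reasoning

c+k≤[1+c]*[k∸a]+a : ∀ {a k} c → a < k → c + k ≤ suc c * (k ∸ a) + a
c+k≤[1+c]*[k∸a]+a {a} {k} c a<k = begin
  c + k                        ≡⟨ cong (c +_) (m∸n+n≡m (<⇒≤ a<k)) ⟨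
  c + (k ∸ a + a)              ≡⟨ +-assoc c (k ∸ a) a ⟨
  c + (k ∸ a) + a              ≡⟨ cong (_+ a) (+-comm c (k ∸ a)) ⟩
  k ∸ a + c + a                ≤⟨ +-monoˡ-≤ a (+-monoʳ-≤ (k ∸ a) c≤c*[k∸a]) ⟩
  k ∸ a + c * (k ∸ a) + a      ∎
  where
  open ≤-Reasoning
  c≤c*[k∸a] : c ≤ c * (k ∸ a)
  c≤c*[k∸a] = subst (_≤ c * (k ∸ a)) (*-identityʳ c) (*-monoʳ-≤ c (m+n≤o⇒m≤o∸n 1 a<k))

1+c≤1⊔[D+2∸k] : ∀ {a k D} c → a < k → c * (k ∸ a) + a ≤ D → suc c ≤ 1 ⊔ (D + 2 ∸ k)
1+c≤1⊔[D+2∸k] {k = k} {D} zero _ _ = m≤m⊔n 1 (D + 2 ∸ k)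
1+c≤1⊔[D+2∸k] {a} {k} {D} (suc c) a<k packed =
  ≤-trans (m+n≤o⇒m≤o∸n (2 + c) 2+c+k≤D+2) (m≤n⊔m 1 _)
  where
  open ≤-Reasoning
  2+c+k≤D+2 : 2 + c + k ≤ D + 2
  2+c+k≤D+2 = begin
    2 + (c + k)  ≤⟨ +-monoʳ-≤ 2 (≤-trans (c+k≤[1+c]*[k∸a]+a c a<k) packed) ⟩
    2 + D        ≡⟨ +-comm 2 D ⟩
    D + 2        ∎

coalition-partners-bound : ∀ {n m k} (G : Graph n) (Θ : Fin m → Subset n) → PairwiseDisjoint Θ →
  ∀ {i J} → (∀ j → j ∈ J → KCoalition k G (Θ i) (Θ j)) →
  ∀ {x i₀} → x ∉ Θ i → ∣ Θ i ∩ N G x ∣ < k → x ∈ Θ i₀ →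
  ∣ J ∣ ≤ 1 ⊔ ((Δ G + 2) ∸ k)
coalition-partners-bound {n} {m} {k} G Θ Θ-disjoint {i} {J} coalition {x} {i₀} x∉A a<k x∈Θi₀ =
  ≤-trans (∣p∣≤1+∣p∩∁⁅x⁆∣ J i₀) (1+c≤1⊔[D+2∸k] ∣ P ∣ a<k packed)
  where
  A  = Θ i
  Nx = N G x
  a  = ∣ A ∩ Nx ∣
  P  = J ∩ ∁ ⁅ i₀ ⁆
  F : Fin m → Subset n
  F j = Θ j ∩ Nx

  partner : ∀ j → j ∈ P → KCoalition k G A (Θ j) × x ∉ Θ j
  partner j j∈P with x∈p∩q⁻ J (∁ ⁅ i₀ ⁆) j∈P
  ... | j∈J , j∉⁅i₀⁆ = coalition j j∈J , λ x∈Θj →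
    x∈∁p⇒x∉p j∉⁅i₀⁆ (subst (_∈ ⁅ i₀ ⁆) (Θ-disjoint i₀ j x x∈Θi₀ x∈Θj) (x∈⁅x⁆ i₀))

  F-disjoint : PairwiseDisjoint F
  F-disjoint j j′ v v∈Fj v∈Fj′ = Θ-disjoint j j′ v (p∩q⊆p _ _ v∈Fj) (p∩q⊆p _ _ v∈Fj′)

  F⊆Nx∖A : ∀ j → j ∈ P → F j ⊆ Nx ∩ ∁ A
  F⊆Nx∖A j j∈P {v} v∈Fj with x∈p∩q⁻ (Θ j) Nx v∈Fj
  ... | v∈Θj , v∈Nx =
    x∈p∩q⁺ (v∈Nx , x∉p⇒x∈∁p (λ v∈A → proj₁ (proj₁ (partner j j∈P)) v v∈A v∈Θj))

  F-large : ∀ j → j ∈ P → k ∸ a ≤ ∣ F j ∣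
  F-large j j∈P = coalition-partner-supplies {G = G} (proj₁ (partner j j∈P)) x∉A (proj₂ (partner j j∈P))

  packed : ∣ P ∣ * (k ∸ a) + a ≤ Δ G
  packed = begin
    ∣ P ∣ * (k ∸ a) + a          ≤⟨ +-monoˡ-≤ a (disjoint-family-card F P F-disjoint F⊆Nx∖A F-large) ⟩
    ∣ Nx ∩ ∁ A ∣ + a             ≡⟨ +-comm _ a ⟩
    a + ∣ Nx ∩ ∁ A ∣             ≡⟨ cong (λ s → ∣ s ∣ + ∣ Nx ∩ ∁ A ∣) (∩-comm A Nx) ⟩
    ∣ Nx ∩ A ∣ + ∣ Nx ∩ ∁ A ∣    ≡⟨ ∣p∩q∣+∣p∩∁q∣≡∣p∣ Nx A ⟩
    degree G x                   ≤⟨ degree≤Δ G x ⟩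
    Δ G                          ∎
    where open ≤-Reasoning

lemma2p3 : (n : ℕ) → 2 ≤ n → (G : Graph n) → (k : ℕ) → 1 ≤ k →
    (m : ℕ) → (Θ : Fin m → Subset n) → IsMaxKCoalitionPartition k G Θ →
    (i : Fin m) → (J : Subset m) → (∀ j → j ∈ J → KCoalition k G (Θ i) (Θ j)) →
    ∣ J ∣ ≤ 1 ⊔ ((Δ G + 2) ∸ k)
lemma2p3 n _ G k _ m Θ (((_ , covers , Θ-disjoint) , _) , _) i J coalition with nonempty? J
... | no J-empty = ≤-trans (≤-reflexive ∣J∣≡0) z≤n
  where
  ∣J∣≡0 : ∣ J ∣ ≡ 0
  ∣J∣≡0 = trans (cong ∣_∣ (Empty-unique J-empty)) (∣⊥∣≡0 m)
... | yes (j , j∈J) with ¬KDominating⇒∃undominated {G = G} (proj₁ (proj₂ (coalition j j∈J)))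
... | x , x∉Θi , a<k =
  coalition-partners-bound G Θ Θ-disjoint coalition x∉Θi a<k (proj₂ (covers x))
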